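{- For every integer $m\ge 1$ and every $n$, there is an injection from $Q_5(m,n)$ to $P_5(-m,n)$.
   Context: Partitions: $\ell(\mu)$ is the number of parts, $s(\mu)$ the smallest part ($s(\emptyset)=+\infty$), $\mu_i=0$ if $\mu$ has fewer than $i$ parts, rank of $\lambda$ is $\lambda_1-\ell(\lambda)$. The rank-set of $\lambda=(\lambda_1\ge\cdots\ge\lambda_\ell>0)$ is $[-\lambda_1,1-\lambda_2,\ldots,\ell-1-\lambda_\ell,\ell,\ell+1,\ldots]$. Fix $m\ge0$. The $m$-Durfee rectangle of $\lambda$ is the largest rectangle with $m+j$ rows and $j$ columns inside the Ferrers diagram (so $j$ is the largest integer with $j=0$ or $\lambda_{m+j}\ge j$). The $m$-Durfee rectangle symbol is $(\alpha,\beta)_{(m+j)\times j}$ with $\alpha_i=\lambda'_{j+i}$ (column lengths to the right of the rectangle, $\lambda'$ the conjugate) and $\beta=(\lambda_{m+j+1},\ldots)$ (rows below the rectangle). $Q(m,n)$ is the set of partitions of $n$ with $m$ in the rank-set; $P(-m,n)$ the set of partitions of $n$ with rank $\ge -m$. $Q_5(m,n)$ is the set of $\lambda\in Q(m,n)$ whose symbol satisfies $j\ge1$, $\ell(\beta)-\ell(\alpha)\ge1$, $\alpha_1=\alpha_2=m+j>\alpha_3$ and $s(\beta)\ge2$. $P_5(-m,n)$ is the set of $\mu\in P(-m,n)$ whose symbol $(\gamma,\delta)_{(m+j')\times j'}$ satisfies $j'\ge1$, $\ell(\gamma)=\ell(\delta)$, $\gamma_1\le m+j'-3$ and $\delta_1=j'$.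 -}

module Defs where

open import Data.Nat using (ℕ; zero; suc; _+_; _∸_; _≤_; _<_; _≤?_)
open import Data.Integer as ℤ using (ℤ; +_; -_)
open import Data.List using (List; []; _∷_; length; filter; map; drop; upTo)
open import Data.Nat.ListAction using (sum)
open import Data.List.Relation.Unary.All using (All)
open import Data.List.Relation.Unary.Linked using (Linked)
open import Data.Maybe using (Maybe; just; nothing)
open import Data.Product using (Σ; _×_; ∃)
open import Data.Sum using (_⊎_)
open import Data.Unit using (⊤)
open import Relation.Binary.PropositionalEquality using (_≡_)
open import Relation.Nullary.Decidable using (does)
open import Data.Bool using (if_then_else_)

IsPartition : List ℕ → Set
IsPartition λs = Linked (λ a b → b ≤ a) λs × All (λ x → 1 ≤ x) λs

IsPartitionOf : ℕ → List ℕ → Set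
IsPartitionOf n λs = IsPartition λs × sum λs ≡ n

ℓ : List ℕ → ℕ
ℓ = length

-- μ_i (1-indexed), = 0 if μ has fewer than i parts (or i = 0)
part : List ℕ → ℕ → ℕ
part []       _             = 0
part (x ∷ xs) zero          = 0
part (x ∷ xs) (suc zero)    = x
part (x ∷ xs) (suc (suc i)) = part xs (suc i)

-- smallest part; nothing encodes s(∅) = +∞
smallest : List ℕ → Maybe ℕ
smallest []           = nothing
smallest (x ∷ [])     = just x
smallest (x ∷ y ∷ ys) = smallest (y ∷ ys)

_≤s_ : ℕ → List ℕ → Set
k ≤s μ with smallest μ
... | nothing = ⊤
... | just s  = k ≤ s

conj : List ℕ → ℕ → ℕ
conj λs k = length (filter (k ≤?_) λs)

rank : List ℕ → ℤ
rank λs = + part λs 1 ℤ.- + ℓ λs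

InRankSet : ℤ → List ℕ → Set
InRankSet k λs =
  (Σ ℕ λ i → 1 ≤ i × i ≤ ℓ λs × (+ (i ∸ 1) ℤ.- + part λs i ≡ k))
  ⊎ (+ ℓ λs ℤ.≤ k)

InQ : ℕ → ℕ → List ℕ → Set
InQ m n λs = IsPartitionOf n λs × InRankSet (+ m) λs

InP- : ℕ → ℕ → List ℕ → Set
InP- m n λs = IsPartitionOf n λs × (- (+ m) ℤ.≤ rank λs)

-- m-Durfee rectangle: largest j with j = 0 or λ_{m+j} ≥ j.
-- Any such j ≥ 1 satisfies m + j ≤ ℓ(λ), so it suffices to search j ≤ ℓ(λ).
durfeeSearch : ℕ → List ℕ → ℕ → ℕ
durfeeSearch m λs zero    = 0
durfeeSearch m λs (suc k) =
  if does (suc k ≤? part λs (m + suc k)) then suc k else durfeeSearch m λs k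

durfee : ℕ → List ℕ → ℕ
durfee m λs = durfeeSearch m λs (ℓ λs)

-- symbol (α, β)_{(m+j)×j}:
-- α_i = λ'_{j+i} for i = 1 .. λ_1 - j (the columns right of the rectangle)
symα : ℕ → List ℕ → List ℕ
symα m λs = map (λ i → conj λs (j + suc i)) (upTo (part λs 1 ∸ j))
  where j = durfee m λs

symβ : ℕ → List ℕ → List ℕ
symβ m λs = drop (m + durfee m λs) λs

InQ5 : ℕ → ℕ → List ℕ → Set
InQ5 m n λs =
  InQ m n λs
  × 1 ≤ j
  × 1 + ℓ α ≤ ℓ β
  × part α 1 ≡ m + j
  × part α 2 ≡ m + j
  × part α 3 < m + j
  × 2 ≤s β
  where
    j = durfee m λs
    α = symα m λs
    β = symβ m λs

InP5 : ℕ → ℕ → List ℕ → Set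
InP5 m n μ =
  InP- m n μ
  × 1 ≤ j'
  × ℓ γ ≡ ℓ δ
  × part γ 1 + 3 ≤ m + j'     -- γ_1 ≤ m + j' - 3 (over ℤ)
  × part δ 1 ≡ j'
  where
    j' = durfee m μ
    γ = symα m μ
    δ = symβ m μ

-- A partition in Q₅(m,n) has m-Durfee symbol ((m+j, m+j, c), (j, R)), the parts of c
-- below m+j and those of R in [2, j]; that β₁ = j is forced by m lying in the rank-set.
-- Enlarging the rectangle to (m+j+1)×(j+1) absorbs the two full columns and the row β₁.
-- The parts of c above j and the parts of R, lowered by one, form γ; the parts of c at
-- most j, raised by one, follow the new first row j+1 of δ, and ones pad δ to the
-- length of γ.  At most one extra part restores the weight; the result has rank −m.
-- Nothing is lost: lowered parts of c stay ≥ j while lowered parts of R drop below j,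
-- raised parts are ≥ 2 while the padding is 1, and a partition is determined by its
-- symbol.

module Submission where

open import Defs
open import Data.Nat using (>-nonZero; ℕ; zero; suc; _+_; _*_; _∸_; _≤_; _<_; _≰_; _≤?_; _<?_; z≤n; s≤s; s≤s⁻¹; pred)
open import Data.Nat.Properties
open import Data.List using (List; []; _∷_; _++_; length; map; take; drop; applyUpTo; upTo; replicate; takeWhile; dropWhile)
open import Data.List.Relation.Binary.Permutation.Propositional using (_↭_; ↭-sym; ↭-trans; ↭⇒↭ₛ)
open import Data.List.Relation.Binary.Permutation.Propositional.Properties using (drop-∷; All-resp-↭; ↭-length)
open import Data.List.Relation.Binary.Pointwise using (Pointwise-≡⇒≡)
open import Data.List.Relation.Unary.Sorted.TotalOrder.Properties using (↗↭↗⇒≋)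
open import Data.Nat.ListAction using (sum)
open import Data.List.Relation.Unary.All as All using (All; []; _∷_)
open import Data.List.Relation.Unary.All.Properties using (map⁺; ++⁺; ++⁻; drop⁺; applyUpTo⁺₁; applyUpTo⁺₂; all-takeWhile; replicate⁺)
open import Data.List.Relation.Unary.Linked as Linked using (Linked; []; [-]; _∷_)
open import Data.List.Relation.Unary.Linked.Properties using (Linked⇒All)
import Data.List.Relation.Unary.Linked.Properties as Linkedₚ
open import Data.List.Relation.Unary.Sorted.TotalOrder using (Sorted)
open import Data.List.Properties
  using ( filter-accept; filter-reject; length-applyUpTo; length-++; length-map; length-replicate; map-upTo
        ; map-applyUpTo; take++drop≡id; ∷-injective; ∷-injectiveʳ; map-injective; takeWhile++dropWhile)
open import Data.Nat.ListAction.Properties using (sum-++; sum-↭)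
import Data.List as List
open import Data.Nat.Tactic.RingSolver using (solve-∀; solve)
open import Data.Product as Product using (Σ; _×_; _,_; proj₁; proj₂; ∃)
open import Data.Maybe using (just)
open import Data.Integer as ℤ using (0ℤ)
import Data.Integer.Properties as ℤP
open import Data.Sum using (inj₁; inj₂)
open import Data.Empty using (⊥-elim)
open import Function using (_∘_; flip)
open import Relation.Binary.Bundles using (DecTotalOrder)
import Relation.Binary.Construct.Flip.EqAndOrd as Flip
open import Relation.Nullary using (¬_; yes; no)
open import Relation.Nullary.Decidable using (dec-true; dec-false)
open import Relation.Binary.PropositionalEquality using (_≡_; refl; sym; trans; cong; cong₂; subst; subst₂; module ≡-Reasoning)
open import Algebra.Properties.CommutativeSemigroup +-commutativeSemigroup using (x∙yz≈y∙xz; interchange)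

≥-decTotalOrder : DecTotalOrder _ _ _
≥-decTotalOrder = Flip.decTotalOrder ≤-decTotalOrder

open import Data.List.Sort.InsertionSort.Base ≥-decTotalOrder using (sort)
open import Data.List.Sort.InsertionSort.Properties ≥-decTotalOrder using (sort-↭; sort-↗)

-- Weakly decreasing lists are the lists sorted for ≥, so the library's insertion sort
-- produces them.
Decreasing : List ℕ → Set
Decreasing = Sorted (DecTotalOrder.totalOrder ≥-decTotalOrder)

at : List ℕ → ℕ → ℕ
at []       _       = 0
at (x ∷ xs) zero    = x
at (x ∷ xs) (suc i) = at xs i

part-suc : ∀ xs i → part xs (suc i) ≡ at xs i
part-suc []       i       = refl
part-suc (x ∷ xs) zero    = refl
part-suc (x ∷ xs) (suc i) = part-suc xs i

part-pred : ∀ xs k → 1 ≤ k → part xs k ≡ at xs (pred k)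
part-pred xs (suc k) _ = part-suc xs k

all-≤-head : ∀ {x xs b} → Decreasing (x ∷ xs) → x ≤ b → All (_≤ b) (x ∷ xs)
all-≤-head d x≤b = Linked⇒All (flip ≤-trans) x≤b d

at-≤ : ∀ {b} xs i → All (_≤ b) xs → at xs i ≤ b
at-≤ []       i       _          = z≤n
at-≤ (x ∷ xs) zero    (x≤b ∷ _)  = x≤b
at-≤ (x ∷ xs) (suc i) (_ ∷ xs≤b) = at-≤ xs i xs≤b

at-antitone : ∀ {xs} → Decreasing xs → ∀ {i i′} → i ≤ i′ → at xs i′ ≤ at xs i
at-antitone {[]}     _   _                            = z≤n
at-antitone {x ∷ xs} _   {zero}  {zero}   _           = ≤-refl
at-antitone {x ∷ xs} xs↓ {zero}  {suc i′} _           = at-≤ xs i′ (All.tail (all-≤-head xs↓ ≤-refl))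
at-antitone {x ∷ xs} xs↓ {suc i} {suc i′} (s≤s i≤i′) = at-antitone (Linked.tail xs↓) i≤i′

all-≤-at₀ : ∀ xs → Decreasing xs → All (_≤ at xs 0) xs
all-≤-at₀ []       _   = []
all-≤-at₀ (x ∷ xs) xs↓ = all-≤-head xs↓ ≤-refl

at-positive⇒< : ∀ xs i → 1 ≤ at xs i → i < length xs
at-positive⇒< (x ∷ xs) zero    _ = s≤s z≤n
at-positive⇒< (x ∷ xs) (suc i) p = s≤s (at-positive⇒< xs i p)

cons-decreasing : ∀ {x xs} → All (_≤ x) xs → Decreasing xs → Decreasing (x ∷ xs)
cons-decreasing []        []  = [-]
cons-decreasing (y≤x ∷ _) xs↓ = y≤x ∷ xs↓

++⁺-decreasing : ∀ {t xs ys} → Decreasing xs → Decreasing ys →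
  All (t ≤_) xs → All (_≤ t) ys → Decreasing (xs ++ ys)
++⁺-decreasing {xs = []}          _            ys↓ _            _         = ys↓
++⁺-decreasing {xs = x ∷ []}      {[]}     _   _   _            _         = [-]
++⁺-decreasing {xs = x ∷ []}      {y ∷ ys} _   ys↓ (t≤x ∷ [])   (y≤t ∷ _) = ≤-trans y≤t t≤x ∷ ys↓
++⁺-decreasing {xs = x ∷ x′ ∷ xs} (x′≤x ∷ xs↓) ys↓ (_ ∷ t≤xs) ys≤t      = x′≤x ∷ ++⁺-decreasing xs↓ ys↓ t≤xs ys≤t

++⁻-decreasing : ∀ xs {ys} → Decreasing (xs ++ ys) → Decreasing xs × Decreasing ys
++⁻-decreasing []            ys↓           = [] , ys↓
++⁻-decreasing (x ∷ [])      xys↓          = [-] , Linked.tail xys↓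
++⁻-decreasing (x ∷ x′ ∷ xs) (x′≤x ∷ xys↓) with ++⁻-decreasing (x′ ∷ xs) xys↓
... | xs↓ , ys↓ = x′≤x ∷ xs↓ , ys↓

drop-decreasing : ∀ n {xs} → Decreasing xs → Decreasing (drop n xs)
drop-decreasing zero             xs↓ = xs↓
drop-decreasing (suc n) {[]}     xs↓ = []
drop-decreasing (suc n) {x ∷ xs} xs↓ = drop-decreasing n (Linked.tail xs↓)

replicate-decreasing : ∀ n x → Decreasing (replicate n x)
replicate-decreasing zero          x = []
replicate-decreasing (suc zero)    x = [-]
replicate-decreasing (suc (suc n)) x = ≤-refl ∷ replicate-decreasing (suc n) x

at-applyUpTo : ∀ (f : ℕ → ℕ) N i → i < N → at (applyUpTo f N) i ≡ f i
at-applyUpTo f (suc N) zero    _   = refl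
at-applyUpTo f (suc N) (suc i) i<N = at-applyUpTo (f ∘ suc) N i (s≤s⁻¹ i<N)

applyUpTo-cong : ∀ {f g : ℕ → ℕ} N → (∀ i → i < N → f i ≡ g i) → applyUpTo f N ≡ applyUpTo g N
applyUpTo-cong zero    f≗g = refl
applyUpTo-cong (suc N) f≗g = cong₂ _∷_ (f≗g 0 (s≤s z≤n)) (applyUpTo-cong N (λ i → f≗g (suc i) ∘ s≤s))

applyUpTo-at : ∀ xs → applyUpTo (at xs) (length xs) ≡ xs
applyUpTo-at []       = refl
applyUpTo-at (x ∷ xs) = cong (x ∷_) (applyUpTo-at xs)

take-applyUpTo-at : ∀ N xs → N ≤ length xs → take N xs ≡ applyUpTo (at xs) N
take-applyUpTo-at zero    xs       _   = refl
take-applyUpTo-at (suc N) (x ∷ xs) N≤n = cong (x ∷_) (take-applyUpTo-at N xs (s≤s⁻¹ N≤n))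

at-++ˡ : ∀ xs ys i → i < length xs → at (xs ++ ys) i ≡ at xs i
at-++ˡ (x ∷ xs) ys zero    _   = refl
at-++ˡ (x ∷ xs) ys (suc i) i<n = at-++ˡ xs ys i (s≤s⁻¹ i<n)

at-++ʳ : ∀ xs ys i → at (xs ++ ys) (length xs + i) ≡ at ys i
at-++ʳ []       ys i = refl
at-++ʳ (x ∷ xs) ys i = at-++ʳ xs ys i

at-drop : ∀ n xs i → at (drop n xs) i ≡ at xs (n + i)
at-drop zero    xs       i = refl
at-drop (suc n) []       i = refl
at-drop (suc n) (x ∷ xs) i = at-drop n xs i

drop-length-++ : ∀ (xs ys : List ℕ) → drop (length xs) (xs ++ ys) ≡ ys
drop-length-++ []       ys = refl
drop-length-++ (x ∷ xs) ys = drop-length-++ xs ys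

sum-map-+ : ∀ k xs → sum (map (k +_) xs) ≡ length xs * k + sum xs
sum-map-+ k []       = refl
sum-map-+ k (x ∷ xs) = trans (cong (k + x +_) (sum-map-+ k xs)) (interchange k x (length xs * k) (sum xs))

sum-replicate : ∀ n x → sum (replicate n x) ≡ n * x
sum-replicate zero    x = refl
sum-replicate (suc n) x = cong (x +_) (sum-replicate n x)

map-pred-decreasing : ∀ {xs} → Decreasing xs → Decreasing (map pred xs)
map-pred-decreasing xs↓ = Linkedₚ.map⁺ (Linked.map pred-mono-≤ xs↓)

map-suc-decreasing : ∀ {xs} → Decreasing xs → Decreasing (map suc xs)
map-suc-decreasing xs↓ = Linkedₚ.map⁺ (Linked.map s≤s xs↓)

map-suc-pred : ∀ {xs} → All (1 ≤_) xs → map suc (map pred xs) ≡ xs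
map-suc-pred []               = refl
map-suc-pred (s≤s z≤n ∷ 1≤xs) = cong (_ ∷_) (map-suc-pred 1≤xs)

map-pred-injective : ∀ {xs ys} → All (1 ≤_) xs → All (1 ≤_) ys → map pred xs ≡ map pred ys → xs ≡ ys
map-pred-injective 1≤xs 1≤ys eq = trans (sym (map-suc-pred 1≤xs)) (trans (cong (map suc) eq) (map-suc-pred 1≤ys))

++-split-unique : ∀ {P : ℕ → Set} {xs ys xs′ ys′} →
  All P xs → All (¬_ ∘ P) ys → All P xs′ → All (¬_ ∘ P) ys′ →
  xs ++ ys ≡ xs′ ++ ys′ → xs ≡ xs′ × ys ≡ ys′
++-split-unique []         _           []           _            eq   = refl , eq
++-split-unique []         (¬py ∷ _)   (px′ ∷ _)    _            refl = ⊥-elim (¬py px′)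
++-split-unique (px ∷ _)   _           []           (¬py′ ∷ _)   refl = ⊥-elim (¬py′ px)
++-split-unique (px ∷ pxs) ¬pys        (px′ ∷ pxs′) ¬pys′        eq with ∷-injective eq
... | refl , eq′ = Product.map₁ (cong (_ ∷_)) (++-split-unique pxs ¬pys pxs′ ¬pys′ eq′)

++-cancelˡ-↭ : ∀ (es : List ℕ) {xs ys} → es ++ xs ↭ es ++ ys → xs ↭ ys
++-cancelˡ-↭ []       p = p
++-cancelˡ-↭ (e ∷ es) p = ++-cancelˡ-↭ es (drop-∷ p)

sort-++-cancelˡ : ∀ es {xs ys} → Decreasing xs → Decreasing ys → sort (es ++ xs) ≡ sort (es ++ ys) → xs ≡ ys
sort-++-cancelˡ es {xs} {ys} xs↓ ys↓ eq = Pointwise-≡⇒≡ (↗↭↗⇒≋ (DecTotalOrder.totalOrder ≥-decTotalOrder) xs↓ ys↓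
  (↭⇒↭ₛ (++-cancelˡ-↭ es (↭-trans (↭-sym (sort-↭ (es ++ xs))) (subst (_↭ es ++ ys) (sym eq) (sort-↭ (es ++ ys)))))))

at₀-dropWhile-< : ∀ j xs → at (dropWhile (j <?_) xs) 0 ≤ j
at₀-dropWhile-< j []       = z≤n
at₀-dropWhile-< j (x ∷ xs) with j <? x
... | yes j<x rewrite dec-true (j <? x) j<x = at₀-dropWhile-< j xs
... | no  j≮x rewrite dec-false (j <? x) j≮x = ≮⇒≥ j≮x

smallest-lowerBound : ∀ x xs → Decreasing (x ∷ xs) → ∃ λ s → smallest (x ∷ xs) ≡ just s × All (s ≤_) (x ∷ xs)
smallest-lowerBound x []       _           = x , refl , ≤-refl ∷ []
smallest-lowerBound x (y ∷ ys) (y≤x ∷ ys↓) with smallest-lowerBound y ys ys↓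
... | s , eq , s≤y ∷ s≤ys = s , eq , ≤-trans s≤y y≤x ∷ s≤y ∷ s≤ys

≤s⇒all-≤ : ∀ {k} xs → Decreasing xs → k ≤s xs → All (k ≤_) xs
≤s⇒all-≤     []       _   _   = []
≤s⇒all-≤ {k} (x ∷ xs) xs↓ k≤s with smallest-lowerBound x xs xs↓
... | s , eq , s≤xs = All.map (≤-trans (≤s-just eq k≤s)) s≤xs
  where
  ≤s-just : smallest (x ∷ xs) ≡ just s → k ≤s (x ∷ xs) → k ≤ s
  ≤s-just eq k≤s with smallest (x ∷ xs)
  ≤s-just refl k≤s | just _ = k≤s

∷∷-shape : ∀ xs {a b} → part xs 1 ≡ a → part xs 2 ≡ b → 1 ≤ b → xs ≡ a ∷ b ∷ drop 2 xs
∷∷-shape (x ∷ y ∷ xs) refl refl _ = refl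
∷∷-shape []           _    refl ()
∷∷-shape (x ∷ [])     _    refl ()

∷-shape : ∀ xs {a} → at xs 0 ≡ a → 1 ≤ length xs → xs ≡ a ∷ drop 1 xs
∷-shape (x ∷ xs) refl _ = refl

+-suc-≤⇒<∸ : ∀ {j t a} → j + suc t ≤ a → t < a ∸ j
+-suc-≤⇒<∸ {j} {t} {a} le = m+n≤o⇒m≤o∸n (suc t) (subst (_≤ a) (+-comm j (suc t)) le)

<∸⇒+-suc-≤ : ∀ {j t a} → j ≤ a → t < a ∸ j → j + suc t ≤ a
<∸⇒+-suc-≤ {j} {t} {a} j≤a lt = subst (_≤ a) (+-comm (suc t) j) (m≤o∸n⇒m+n≤o (suc t) j≤a lt)

m-n≡o⇒m≡o+n : ∀ a b c → ℤ.+ a ℤ.- ℤ.+ b ≡ ℤ.+ c → a ≡ c + b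
m-n≡o⇒m≡o+n a b c eq = ℤP.+-injective (begin
  ℤ.+ a                                ≡⟨ ℤP.+-identityʳ (ℤ.+ a) ⟨
  ℤ.+ a ℤ.+ 0ℤ                         ≡⟨ cong (ℤ._+_ (ℤ.+ a)) (ℤP.+-inverseˡ (ℤ.+ b)) ⟨
  ℤ.+ a ℤ.+ (ℤ.- ℤ.+ b ℤ.+ ℤ.+ b)      ≡⟨ ℤP.+-assoc (ℤ.+ a) (ℤ.- ℤ.+ b) (ℤ.+ b) ⟨
  ℤ.+ a ℤ.- ℤ.+ b ℤ.+ ℤ.+ b            ≡⟨ cong (ℤ._+ ℤ.+ b) eq ⟩
  ℤ.+ c ℤ.+ ℤ.+ b                      ≡⟨ ℤP.pos-+ c b ⟨
  ℤ.+ (c + b)                          ∎)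
  where open ≡-Reasoning

-- Conjugates

conj-∷-≤ : ∀ {x xs k} → k ≤ x → conj (x ∷ xs) k ≡ suc (conj xs k)
conj-∷-≤ {x} {xs} {k} k≤x = cong length (filter-accept (k ≤?_) {x} {xs} k≤x)

conj-∷-≰ : ∀ {x xs k} → k ≰ x → conj (x ∷ xs) k ≡ conj xs k
conj-∷-≰ {x} {xs} {k} k≰x = cong length (filter-reject (k ≤?_) {x} {xs} k≰x)

conj-++ : ∀ xs ys k → conj (xs ++ ys) k ≡ conj xs k + conj ys k
conj-++ []       ys k = refl
conj-++ (x ∷ xs) ys k with k ≤? x
... | yes k≤x rewrite conj-∷-≤ {x} {xs ++ ys} k≤x | conj-∷-≤ {x} {xs} k≤x = cong suc (conj-++ xs ys k)
... | no  k≰x rewrite conj-∷-≰ {x} {xs ++ ys} k≰x | conj-∷-≰ {x} {xs} k≰x = conj-++ xs ys k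

conj-all-< : ∀ {k} xs → All (_< k) xs → conj xs k ≡ 0
conj-all-< []       []           = refl
conj-all-< (x ∷ xs) (x<k ∷ xs<k) = trans (conj-∷-≰ (<⇒≱ x<k)) (conj-all-< xs xs<k)

conj-1 : ∀ xs → All (1 ≤_) xs → conj xs 1 ≡ length xs
conj-1 []       []           = refl
conj-1 (x ∷ xs) (1≤x ∷ 1≤xs) = trans (conj-∷-≤ 1≤x) (cong suc (conj-1 xs 1≤xs))

conj-antitone : ∀ xs {k k′} → k ≤ k′ → conj xs k′ ≤ conj xs k
conj-antitone []       _    = z≤n
conj-antitone (x ∷ xs) {k} {k′} k≤k′ with k′ ≤? x | k ≤? x
... | yes k′≤x | yes k≤x rewrite conj-∷-≤ {x} {xs} k′≤x | conj-∷-≤ {x} {xs} k≤x = s≤s (conj-antitone xs k≤k′)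
... | yes k′≤x | no  k≰x = ⊥-elim (k≰x (≤-trans k≤k′ k′≤x))
... | no  k′≰x | yes k≤x rewrite conj-∷-≰ {x} {xs} k′≰x | conj-∷-≤ {x} {xs} k≤x = m≤n⇒m≤1+n (conj-antitone xs k≤k′)
... | no  k′≰x | no  k≰x rewrite conj-∷-≰ {x} {xs} k′≰x | conj-∷-≰ {x} {xs} k≰x = conj-antitone xs k≤k′

conj-above-head : ∀ {x xs k} → Decreasing (x ∷ xs) → k ≰ x → conj (x ∷ xs) k ≡ 0
conj-above-head {x} {xs} d k≰x =
  conj-all-< (x ∷ xs) (All.map (λ y≤x → ≤-<-trans y≤x (≰⇒> k≰x)) (all-≤-head d ≤-refl))

<conj⇒≤at : ∀ {k} xs i → Decreasing xs → i < conj xs k → k ≤ at xs i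
<conj⇒≤at {k} (x ∷ xs) i d i<c with k ≤? x
<conj⇒≤at (x ∷ xs) zero    d i<c | yes k≤x = k≤x
<conj⇒≤at (x ∷ xs) (suc i) d i<c | yes k≤x rewrite conj-∷-≤ {x} {xs} k≤x =
  <conj⇒≤at xs i (Linked.tail d) (s≤s⁻¹ i<c)
... | no k≰x rewrite conj-above-head d k≰x = ⊥-elim (n≮0 i<c)

≤at⇒<conj : ∀ {k} xs i → Decreasing xs → 1 ≤ k → k ≤ at xs i → i < conj xs k
≤at⇒<conj {k} []       i d 1≤k k≤0 = ⊥-elim (<⇒≱ 1≤k k≤0)
≤at⇒<conj {k} (x ∷ xs) i d 1≤k k≤xᵢ with k ≤? x
≤at⇒<conj (x ∷ xs) zero    d 1≤k k≤xᵢ | yes k≤x rewrite conj-∷-≤ {x} {xs} k≤x = s≤s z≤n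
≤at⇒<conj (x ∷ xs) (suc i) d 1≤k k≤xᵢ | yes k≤x rewrite conj-∷-≤ {x} {xs} k≤x =
  s≤s (≤at⇒<conj xs i (Linked.tail d) 1≤k k≤xᵢ)
... | no k≰x = ⊥-elim (k≰x (≤-trans k≤xᵢ (at-antitone d {0} {i} z≤n)))

conj-applyUpTo : ∀ {k} (f : ℕ → ℕ) N c → c ≤ N →
  (∀ i → k ≤ f i → i < c) → (∀ i → i < c → k ≤ f i) → conj (applyUpTo f N) k ≡ c
conj-applyUpTo {k} f zero    zero    _ _ _ = refl
conj-applyUpTo {k} f (suc N) c c≤N ≥k⇒<c <c⇒≥k with k ≤? f 0
conj-applyUpTo f (suc N) zero    _ ≥k⇒<c <c⇒≥k | yes k≤f₀ = ⊥-elim (n≮0 (≥k⇒<c 0 k≤f₀))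
conj-applyUpTo f (suc N) (suc c) c≤N ≥k⇒<c <c⇒≥k | yes k≤f₀
  rewrite conj-∷-≤ {f 0} {applyUpTo (f ∘ suc) N} k≤f₀ =
  cong suc (conj-applyUpTo (f ∘ suc) N c (s≤s⁻¹ c≤N) (λ i → s≤s⁻¹ ∘ ≥k⇒<c (suc i)) (λ i → <c⇒≥k (suc i) ∘ s≤s))
conj-applyUpTo f (suc N) zero    _ ≥k⇒<c <c⇒≥k | no k≰f₀
  rewrite conj-∷-≰ {f 0} {applyUpTo (f ∘ suc) N} k≰f₀ =
  conj-applyUpTo (f ∘ suc) N zero z≤n (λ i → ⊥-elim ∘ n≮0 ∘ ≥k⇒<c (suc i)) (λ _ ())
conj-applyUpTo f (suc N) (suc c) _ ≥k⇒<c <c⇒≥k | no k≰f₀ = ⊥-elim (k≰f₀ (<c⇒≥k 0 (s≤s z≤n)))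

conj-1+sum-map-pred : ∀ xs → conj xs 1 + sum (map pred xs) ≡ sum xs
conj-1+sum-map-pred []           = refl
conj-1+sum-map-pred (zero ∷ xs)  = conj-1+sum-map-pred xs
conj-1+sum-map-pred (suc x ∷ xs) =
  cong suc (trans (x∙yz≈y∙xz (conj xs 1) x _) (cong (x +_) (conj-1+sum-map-pred xs)))

conj-map-pred : ∀ xs k → conj (map pred xs) (suc k) ≡ conj xs (suc (suc k))
conj-map-pred []           k = refl
conj-map-pred (zero ∷ xs)  k = conj-map-pred xs k
conj-map-pred (suc x ∷ xs) k with suc k ≤? x
... | yes k<x rewrite conj-∷-≤ {x} {map pred xs} k<x | conj-∷-≤ {suc x} {xs} (s≤s k<x) = cong suc (conj-map-pred xs k)
... | no  k≮x rewrite conj-∷-≰ {x} {map pred xs} k≮x | conj-∷-≰ {suc x} {xs} (k≮x ∘ s≤s⁻¹) = conj-map-pred xs k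

sum-conj : ∀ N xs → All (_≤ N) xs → sum (applyUpTo (λ i → conj xs (suc i)) N) ≡ sum xs
sum-conj zero    xs xs≤0 = sym (sum-all-0 xs xs≤0)
  where
  sum-all-0 : ∀ xs → All (_≤ 0) xs → sum xs ≡ 0
  sum-all-0 []       []          = refl
  sum-all-0 (x ∷ xs) (z≤n ∷ xs≤0) = sum-all-0 xs xs≤0
sum-conj (suc N) xs xs≤1+N = begin
  conj xs 1 + sum (applyUpTo (λ i → conj xs (suc (suc i))) N)
    ≡⟨ cong (λ ys → conj xs 1 + sum ys) (applyUpTo-cong N (λ i _ → sym (conj-map-pred xs i))) ⟩
  conj xs 1 + sum (applyUpTo (λ i → conj (map pred xs) (suc i)) N)
    ≡⟨ cong (conj xs 1 +_) (sum-conj N (map pred xs) (map⁺ (All.map pred-mono-≤ xs≤1+N))) ⟩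
  conj xs 1 + sum (map pred xs)
    ≡⟨ conj-1+sum-map-pred xs ⟩
  sum xs ∎
  where open ≡-Reasoning

-- The m-Durfee rectangle

record IsDurfeeUpTo (m : ℕ) (λs : List ℕ) (L j : ℕ) : Set where
  field
    bounded : j ≤ L
    fits    : 1 ≤ j → j ≤ part λs (m + j)
    maximal : ∀ k → j < k → k ≤ L → k ≰ part λs (m + k)

durfeeSearch-isDurfee : ∀ m λs L → IsDurfeeUpTo m λs L (durfeeSearch m λs L)
durfeeSearch-isDurfee m λs zero = record
  { bounded = z≤n ; fits = λ () ; maximal = λ k 0<k k≤0 → ⊥-elim (<⇒≱ 0<k k≤0) }
durfeeSearch-isDurfee m λs (suc L) with suc L ≤? part λs (m + suc L)
... | yes fits rewrite dec-true (suc L ≤? part λs (m + suc L)) fits = record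
  { bounded = ≤-refl ; fits = λ _ → fits ; maximal = λ k L<k k≤L → ⊥-elim (<⇒≱ L<k k≤L) }
... | no  ¬fits rewrite dec-false (suc L ≤? part λs (m + suc L)) ¬fits = record
  { bounded = m≤n⇒m≤1+n bounded ; fits = fits ; maximal = maximal′ }
  where
  open IsDurfeeUpTo (durfeeSearch-isDurfee m λs L)
  maximal′ : ∀ k → durfeeSearch m λs L < k → k ≤ suc L → k ≰ part λs (m + k)
  maximal′ k j<k k≤1+L with m≤n⇒m<n∨m≡n k≤1+L
  ... | inj₁ k≤L = maximal k j<k (s≤s⁻¹ k≤L)
  ... | inj₂ refl = ¬fits

isDurfee-≤ : ∀ {m λs L i j} → IsDurfeeUpTo m λs L i → IsDurfeeUpTo m λs L j → j ≤ i
isDurfee-≤ {j = j} dᵢ dⱼ = ≮⇒≥ λ i<j →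
  IsDurfeeUpTo.maximal dᵢ j i<j (IsDurfeeUpTo.bounded dⱼ) (IsDurfeeUpTo.fits dⱼ (≤-trans (s≤s z≤n) i<j))

isDurfee-unique : ∀ {m λs L i j} → IsDurfeeUpTo m λs L i → IsDurfeeUpTo m λs L j → i ≡ j
isDurfee-unique dᵢ dⱼ = ≤-antisym (isDurfee-≤ dⱼ dᵢ) (isDurfee-≤ dᵢ dⱼ)

durfee-isDurfee : ∀ m λs → IsDurfeeUpTo m λs (ℓ λs) (durfee m λs)
durfee-isDurfee m λs = durfeeSearch-isDurfee m λs (ℓ λs)

-- Durfee rectangle symbols

-- Row i+1 of the partition with symbol (α, β)_{(m+j)×j}: j cells in the rectangle and
-- α'_{i+1} to its right.
rows : ℕ → ℕ → List ℕ → List ℕ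
rows m j α = applyUpTo (λ i → j + conj α (suc i)) (m + j)

fromSymbol : ℕ → ℕ → List ℕ → List ℕ → List ℕ
fromSymbol m j α β = rows m j α ++ β

record IsSymbol (m j : ℕ) (α β : List ℕ) : Set where
  field
    j-positive   : 1 ≤ j
    α-decreasing : Decreasing α
    α-positive   : All (1 ≤_) α
    α-bounded    : All (_≤ m + j) α
    β-decreasing : Decreasing β
    β-positive   : All (1 ≤_) β
    β-bounded    : All (_≤ j) β

length-rows : ∀ m j α → length (rows m j α) ≡ m + j
length-rows m j α = length-applyUpTo _ (m + j)

length-fromSymbol : ∀ m j α β → length (fromSymbol m j α β) ≡ m + j + length β
length-fromSymbol m j α β = trans (length-++ (rows m j α)) (cong (_+ length β) (length-rows m j α))

at-fromSymbol-rows : ∀ m j α β i → i < m + j → at (fromSymbol m j α β) i ≡ j + conj α (suc i)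
at-fromSymbol-rows m j α β i i<m+j =
  trans (at-++ˡ (rows m j α) β i (subst (i <_) (sym (length-rows m j α)) i<m+j))
        (at-applyUpTo _ (m + j) i i<m+j)

at-fromSymbol-β : ∀ m j α β d → at (fromSymbol m j α β) (m + j + d) ≡ at β d
at-fromSymbol-β m j α β d =
  trans (cong (λ n → at (fromSymbol m j α β) (n + d)) (sym (length-rows m j α)))
        (at-++ʳ (rows m j α) β d)

module FromSymbol {m j α β} (s : IsSymbol m j α β) where
  open IsSymbol s

  private
    μ : List ℕ
    μ = fromSymbol m j α β

  fromSymbol-isPartition : IsPartition μ
  fromSymbol-isPartition =
    ++⁺-decreasing {t = j} rows↓ β-decreasing (applyUpTo⁺₂ _ (m + j) (λ _ → m≤m+n j _)) β-bounded ,
    ++⁺ (applyUpTo⁺₂ _ (m + j) (λ _ → ≤-trans j-positive (m≤m+n j _))) β-positive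
    where
    rows↓ : Decreasing (rows m j α)
    rows↓ = Linkedₚ.applyUpTo⁺₂ _ (m + j) (λ i → +-monoʳ-≤ j (conj-antitone α (n≤1+n (suc i))))

  part-fromSymbol-rows : part μ (m + j) ≡ j + conj α (m + j)
  part-fromSymbol-rows = begin
    part μ (m + j)                   ≡⟨ part-pred μ (m + j) m+j-positive ⟩
    at μ (pred (m + j))              ≡⟨ at-fromSymbol-rows m j α β _ (≤-reflexive suc-pred[m+j]) ⟩
    j + conj α (suc (pred (m + j)))  ≡⟨ cong (λ n → j + conj α n) suc-pred[m+j] ⟩
    j + conj α (m + j)               ∎
    where
    open ≡-Reasoning
    m+j-positive : 1 ≤ m + j
    m+j-positive = ≤-trans j-positive (m≤n+m j m)
    suc-pred[m+j] : suc (pred (m + j)) ≡ m + j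
    suc-pred[m+j] = suc-pred (m + j) ⦃ >-nonZero m+j-positive ⦄

  part-fromSymbol-β : ∀ d → part μ (m + suc (j + d)) ≡ at β d
  part-fromSymbol-β d = begin
    part μ (m + suc (j + d))  ≡⟨ cong (part μ) (+-suc m (j + d)) ⟩
    part μ (suc (m + (j + d))) ≡⟨ part-suc μ _ ⟩
    at μ (m + (j + d))        ≡⟨ cong (at μ) (sym (+-assoc m j d)) ⟩
    at μ (m + j + d)          ≡⟨ at-fromSymbol-β m j α β d ⟩
    at β d                    ∎
    where open ≡-Reasoning

  durfee-fromSymbol : durfee m μ ≡ j
  durfee-fromSymbol = sym (isDurfee-unique isDurfee (durfee-isDurfee m μ))
    where
    maximal : ∀ k → j < k → k ≰ part μ (m + k)
    maximal k j<k with m≤n⇒∃[o]m+o≡n j<k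
    ... | d , refl = λ k≤part → <⇒≱ (s≤s (m≤m+n j d))
      (≤-trans k≤part (≤-trans (≤-reflexive (part-fromSymbol-β d)) (at-≤ β d β-bounded)))
    isDurfee : IsDurfeeUpTo m μ (ℓ μ) j
    isDurfee = record
      { bounded = subst (j ≤_) (sym (length-fromSymbol m j α β)) (≤-trans (m≤n+m j m) (m≤m+n _ _))
      ; fits    = λ _ → ≤-trans (m≤m+n j _) (≤-reflexive (sym part-fromSymbol-rows))
      ; maximal = λ k j<k _ → maximal k j<k
      }

  part₁-fromSymbol : part μ 1 ≡ j + length α
  part₁-fromSymbol = begin
    part μ 1          ≡⟨ part-suc μ 0 ⟩
    at μ 0            ≡⟨ at-fromSymbol-rows m j α β 0 (≤-trans j-positive (m≤n+m j m)) ⟩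
    j + conj α 1      ≡⟨ cong (j +_) (conj-1 α α-positive) ⟩
    j + length α      ∎
    where open ≡-Reasoning

  conj-fromSymbol : ∀ t → conj μ (j + suc t) ≡ at α t
  conj-fromSymbol t = begin
    conj μ (j + suc t)                              ≡⟨ conj-++ (rows m j α) β _ ⟩
    conj (rows m j α) (j + suc t) + conj β (j + suc t) ≡⟨ cong₂ _+_ conj-rows (conj-all-< β β<) ⟩
    at α t + 0                                      ≡⟨ +-identityʳ _ ⟩
    at α t                                          ∎
    where
    open ≡-Reasoning
    β< : All (_< j + suc t) β
    β< = All.map (λ b≤j → ≤-<-trans b≤j (m<m+n j (s≤s z≤n))) β-bounded
    conj-rows : conj (rows m j α) (j + suc t) ≡ at α t
    conj-rows = conj-applyUpTo _ (m + j) (at α t) (at-≤ α t α-bounded)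
      (λ i t<αᵢ → <conj⇒≤at α t α-decreasing (+-cancelˡ-≤ j (suc t) _ t<αᵢ))
      (λ i i<αₜ → +-monoʳ-≤ j (≤at⇒<conj α t α-decreasing (s≤s z≤n) i<αₜ))

  symα-fromSymbol : symα m μ ≡ α
  symα-fromSymbol = begin
    map (λ i → conj μ (durfee m μ + suc i)) (upTo (part μ 1 ∸ durfee m μ))
      ≡⟨ cong₂ (λ d n → map (λ i → conj μ (d + suc i)) (upTo n)) durfee-fromSymbol length-α ⟩
    map (λ i → conj μ (j + suc i)) (upTo (length α))  ≡⟨ map-upTo _ (length α) ⟩
    applyUpTo (λ i → conj μ (j + suc i)) (length α)   ≡⟨ applyUpTo-cong (length α) (λ i _ → conj-fromSymbol i) ⟩
    applyUpTo (at α) (length α)                       ≡⟨ applyUpTo-at α ⟩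
    α                                                 ∎
    where
    open ≡-Reasoning
    length-α : part μ 1 ∸ durfee m μ ≡ length α
    length-α = trans (cong₂ _∸_ part₁-fromSymbol durfee-fromSymbol) (m+n∸m≡n j (length α))

  symβ-fromSymbol : symβ m μ ≡ β
  symβ-fromSymbol = begin
    drop (m + durfee m μ) μ  ≡⟨ cong (λ d → drop (m + d) μ) durfee-fromSymbol ⟩
    drop (m + j) μ           ≡⟨ cong (λ n → drop n μ) (sym (length-rows m j α)) ⟩
    drop (length (rows m j α)) μ ≡⟨ drop-length-++ (rows m j α) β ⟩
    β                        ∎
    where open ≡-Reasoning

  sum-fromSymbol : sum μ ≡ (m + j) * j + sum α + sum β
  sum-fromSymbol = begin
    sum μ                                                         ≡⟨ sum-++ (rows m j α) β ⟩
    sum (rows m j α) + sum β                                      ≡⟨ cong (λ xs → sum xs + sum β) rows≡map ⟩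
    sum (map (j +_) (applyUpTo (λ i → conj α (suc i)) (m + j))) + sum β
      ≡⟨ cong (_+ sum β) (sum-map-+ j (applyUpTo (λ i → conj α (suc i)) (m + j))) ⟩
    length (applyUpTo (λ i → conj α (suc i)) (m + j)) * j + sum (applyUpTo (λ i → conj α (suc i)) (m + j)) + sum β
      ≡⟨ cong₂ (λ l s → l * j + s + sum β) (length-applyUpTo _ (m + j)) (sum-conj (m + j) α α-bounded) ⟩
    (m + j) * j + sum α + sum β                                   ∎
    where
    open ≡-Reasoning
    rows≡map : rows m j α ≡ map (j +_) (applyUpTo (λ i → conj α (suc i)) (m + j))
    rows≡map = sym (map-applyUpTo _ (j +_) (m + j))

  rank-fromSymbol : length α ≡ length β → rank μ ≡ ℤ.- ℤ.+ m
  rank-fromSymbol ℓα≡ℓβ = begin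
    ℤ.+ part μ 1 ℤ.- ℤ.+ ℓ μ
      ≡⟨ cong₂ (λ a b → ℤ.+ a ℤ.- ℤ.+ b) part₁-fromSymbol (length-fromSymbol m j α β) ⟩
    ℤ.+ (j + length α) ℤ.- ℤ.+ (m + j + length β)
      ≡⟨ cong (λ n → ℤ.+ (j + length α) ℤ.- ℤ.+ n) (trans (+-assoc m j _) (cong (λ l → m + (j + l)) (sym ℓα≡ℓβ))) ⟩
    ℤ.+ (j + length α) ℤ.- ℤ.+ (m + (j + length α))   ≡⟨ ℤP.m-n≡m⊖n (j + length α) (m + (j + length α)) ⟩
    (j + length α) ℤ.⊖ (m + (j + length α))           ≡⟨ ℤP.⊖-≤ (m≤n+m _ m) ⟩
    ℤ.- ℤ.+ (m + (j + length α) ∸ (j + length α))     ≡⟨ cong (λ n → ℤ.- ℤ.+ n) (m+n∸n≡m m (j + length α)) ⟩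
    ℤ.- ℤ.+ m                                         ∎
    where open ≡-Reasoning

fromSymbol-injective : ∀ {m j α β j′ α′ β′} → IsSymbol m j α β → IsSymbol m j′ α′ β′ →
  fromSymbol m j α β ≡ fromSymbol m j′ α′ β′ → j ≡ j′ × α ≡ α′ × β ≡ β′
fromSymbol-injective {m} s s′ eq =
  recover durfee S.durfee-fromSymbol S′.durfee-fromSymbol ,
  recover symα S.symα-fromSymbol S′.symα-fromSymbol ,
  recover symβ S.symβ-fromSymbol S′.symβ-fromSymbol
  where
  module S  = FromSymbol s
  module S′ = FromSymbol s′
  recover : ∀ {A : Set} {a a′ : A} (f : ℕ → List ℕ → A) → f m _ ≡ a → f m _ ≡ a′ → a ≡ a′
  recover f fμ≡a fμ′≡a′ = trans (sym fμ≡a) (trans (cong (f m) eq) fμ′≡a′)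

module SymbolOf (m : ℕ) {λs : List ℕ} (λ-partition : IsPartition λs) (j-positive : 1 ≤ durfee m λs) where
  private
    j : ℕ
    j = durfee m λs
    α β : List ℕ
    α = symα m λs
    β = symβ m λs
    λ↓ : Decreasing λs
    λ↓ = proj₁ λ-partition
    open IsDurfeeUpTo (durfee-isDurfee m λs)

    m+j-positive : 1 ≤ m + j
    m+j-positive = ≤-trans j-positive (m≤n+m j m)
    fits′ : j ≤ at λs (pred (m + j))
    fits′ = subst (j ≤_) (part-pred λs _ m+j-positive) (fits j-positive)

  m+j≤ℓ : m + j ≤ ℓ λs
  m+j≤ℓ = subst (_≤ ℓ λs) (suc-pred (m + j) ⦃ >-nonZero m+j-positive ⦄)
    (at-positive⇒< λs _ (≤-trans j-positive fits′))

  j≤at-rows : ∀ i → i < m + j → j ≤ at λs i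
  j≤at-rows i i<m+j = ≤-trans fits′ (at-antitone λ↓ (<⇒≤pred i<m+j))

  at-below-durfee : at λs (m + j) ≤ j
  at-below-durfee = ≮⇒≥ λ j<at → maximal (suc j) ≤-refl
    (≤-trans (s≤s (m≤n+m j m)) (at-positive⇒< λs (m + j) (≤-trans (s≤s z≤n) j<at)))
    (≤-trans j<at (≤-reflexive (sym (trans (cong (part λs) (+-suc m j)) (part-suc λs (m + j))))))

  private
    M : ℕ
    M = part λs 1 ∸ j
    α≡ : α ≡ applyUpTo (λ t → conj λs (j + suc t)) M
    α≡ = map-upTo _ M
    at₀≡part₁ : at λs 0 ≡ part λs 1
    at₀≡part₁ = sym (part-suc λs 0)

  conj-symα : ∀ i → i < m + j → conj α (suc i) ≡ at λs i ∸ j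
  conj-symα i i<m+j = trans (cong (λ xs → conj xs (suc i)) α≡)
    (conj-applyUpTo _ M (at λs i ∸ j) (∸-monoˡ-≤ j (≤-trans (at-antitone λ↓ z≤n) (≤-reflexive at₀≡part₁)))
      (λ t i<c → +-suc-≤⇒<∸ (<conj⇒≤at λs i λ↓ i<c))
      (λ t t<c → ≤at⇒<conj λs i λ↓ (≤-trans (s≤s z≤n) (m≤n+m (suc t) j)) (<∸⇒+-suc-≤ (j≤at-rows i i<m+j) t<c)))

  symbol-isSymbol : IsSymbol m j α β
  symbol-isSymbol = record
    { j-positive   = j-positive
    ; α-decreasing = subst Decreasing (sym α≡)
        (Linkedₚ.applyUpTo⁺₂ _ M (λ t → conj-antitone λs (+-monoʳ-≤ j (n≤1+n (suc t)))))
    ; α-positive   = subst (All (1 ≤_)) (sym α≡) (applyUpTo⁺₁ _ M λ {t} t<M →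
        ≤at⇒<conj λs 0 λ↓ (≤-trans (s≤s z≤n) (m≤n+m (suc t) j))
          (<∸⇒+-suc-≤ (j≤at-rows 0 m+j-positive) (subst (λ a → t < a ∸ j) (sym at₀≡part₁) t<M)))
    ; α-bounded    = subst (All (_≤ m + j)) (sym α≡) (applyUpTo⁺₂ _ M λ t →
        ≤-trans (conj-antitone λs {suc j} (≤-trans (s≤s (m≤m+n j t)) (≤-reflexive (sym (+-suc j t))))) conj-above-durfee)
    ; β-decreasing = β↓
    ; β-positive   = drop⁺ (m + j) (proj₂ λ-partition)
    ; β-bounded    = All.map (λ b≤β₀ → ≤-trans b≤β₀ β₀≤j) (all-≤-at₀ β β↓)
    }
    where
    β↓ : Decreasing β
    β↓ = drop-decreasing (m + j) λ↓
    β₀≤j : at β 0 ≤ j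
    β₀≤j = subst (_≤ j) (sym (trans (at-drop (m + j) λs 0) (cong (at λs) (+-identityʳ (m + j))))) at-below-durfee
    conj-above-durfee : conj λs (suc j) ≤ m + j
    conj-above-durfee = ≮⇒≥ λ m+j<c → <⇒≱ (s≤s ≤-refl) (≤-trans (<conj⇒≤at λs (m + j) λ↓ m+j<c) at-below-durfee)

  fromSymbol-symbol : fromSymbol m j α β ≡ λs
  fromSymbol-symbol = begin
    rows m j α ++ β                 ≡⟨ cong (_++ β) rows≡take ⟩
    take (m + j) λs ++ drop (m + j) λs ≡⟨ take++drop≡id (m + j) λs ⟩
    λs                              ∎
    where
    open ≡-Reasoning
    rows≡take : rows m j α ≡ take (m + j) λs
    rows≡take = trans
      (applyUpTo-cong (m + j) (λ i i<m+j →
        trans (cong (j +_) (conj-symα i i<m+j)) (m+[n∸m]≡n (j≤at-rows i i<m+j))))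
      (sym (take-applyUpTo-at (m + j) λs m+j≤ℓ))

  -- If (i−1) − λᵢ = m, row i cannot meet the rectangle (there λᵢ ≥ j would give i > m+j),
  -- so i = m+j+1+d with λᵢ = β_{d+1} ≤ j, and then j + d = β_{d+1} forces d = 0.
  m∈rankSet⇒β₁≡j : InRankSet (ℤ.+ m) λs → at β 0 ≡ j
  m∈rankSet⇒β₁≡j (inj₂ ℓ≤m) = ⊥-elim (<⇒≱ (<-≤-trans (m<m+n m j-positive) m+j≤ℓ) (ℤP.drop‿+≤+ ℓ≤m))
  m∈rankSet⇒β₁≡j (inj₁ (suc i , _ , _ , i-λᵢ≡m)) with i <? m + j
  ... | yes i<m+j = ⊥-elim (<⇒≱ i<m+j (subst (m + j ≤_) (sym i≡m+λᵢ)
          (+-monoʳ-≤ m (subst (j ≤_) (sym (part-suc λs i)) (j≤at-rows i i<m+j)))))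
    where
    i≡m+λᵢ : i ≡ m + part λs (suc i)
    i≡m+λᵢ = m-n≡o⇒m≡o+n i (part λs (suc i)) m i-λᵢ≡m
  ... | no  i≮m+j with m≤n⇒∃[o]m+o≡n (≮⇒≥ i≮m+j)
  ...   | d , refl = trans (subst (λ e → at β e ≡ j + e) d≡0 βd≡j+d) (+-identityʳ j)
    where
    βd≡j+d : at β d ≡ j + d
    βd≡j+d = +-cancelˡ-≡ m _ _ (begin
      m + at β d                    ≡⟨ cong (m +_) (trans (at-drop (m + j) λs d) (sym (part-suc λs _))) ⟩
      m + part λs (suc (m + j + d)) ≡⟨ m-n≡o⇒m≡o+n (m + j + d) _ m i-λᵢ≡m ⟨
      m + j + d                     ≡⟨ +-assoc m j d ⟩
      m + (j + d)                   ∎)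
      where open ≡-Reasoning
    d≡0 : d ≡ 0
    d≡0 = n≤0⇒n≡0 (+-cancelˡ-≤ j d 0 (begin
      j + d   ≡⟨ βd≡j+d ⟨
      at β d  ≤⟨ at-≤ β d (IsSymbol.β-bounded symbol-isSymbol) ⟩
      j       ≡⟨ +-identityʳ j ⟨
      j + 0   ∎))
      where open ≤-Reasoning

record IsQ5Symbol (m j : ℕ) (c R : List ℕ) : Set where
  field
    j-positive   : 1 ≤ j
    c-decreasing : Decreasing c
    c-positive   : All (1 ≤_) c
    c-bounded    : All (_< m + j) c
    R-decreasing : Decreasing R
    R-lower      : All (2 ≤_) R
    R-upper      : All (_≤ j) R
    R-long       : 2 + length c ≤ length R

fromQ5Symbol : ℕ → ℕ → List ℕ → List ℕ → List ℕ
fromQ5Symbol m j c R = fromSymbol m j (m + j ∷ m + j ∷ c) (j ∷ R)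

q5-isSymbol : ∀ {m j c R} → IsQ5Symbol m j c R → IsSymbol m j (m + j ∷ m + j ∷ c) (j ∷ R)
q5-isSymbol {m} {j} {c} q = record
  { j-positive   = j-positive
  ; α-decreasing = ≤-refl ∷ cons-decreasing c≤m+j c-decreasing
  ; α-positive   = m+j-positive ∷ m+j-positive ∷ c-positive
  ; α-bounded    = ≤-refl ∷ ≤-refl ∷ c≤m+j
  ; β-decreasing = cons-decreasing R-upper R-decreasing
  ; β-positive   = j-positive ∷ All.map (≤-trans (s≤s z≤n)) R-lower
  ; β-bounded    = ≤-refl ∷ R-upper
  }
  where
  open IsQ5Symbol q
  m+j-positive : 1 ≤ m + j
  m+j-positive = ≤-trans j-positive (m≤n+m j m)
  c≤m+j : All (_≤ m + j) c
  c≤m+j = All.map <⇒≤ c-bounded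

q5-decomposition : ∀ {m n λs} → InQ5 m n λs →
  IsQ5Symbol m (durfee m λs) (drop 2 (symα m λs)) (drop 1 (symβ m λs))
  × fromQ5Symbol m (durfee m λs) (drop 2 (symα m λs)) (drop 1 (symβ m λs)) ≡ λs
q5-decomposition {m} {n} {λs} (((λ-partition , _) , m∈rankSet) , j-positive , α<β , α₁≡ , α₂≡ , α₃< , 2≤sβ) =
  isQ5Symbol , trans (cong₂ (fromSymbol m j) (sym α-shape) (sym β-shape)) fromSymbol-symbol
  where
  open SymbolOf m λ-partition j-positive
  open IsSymbol symbol-isSymbol hiding (j-positive)
  j : ℕ
  j = durfee m λs
  α β c R : List ℕ
  α = symα m λs
  β = symβ m λs
  c = drop 2 α
  R = drop 1 β
  α-shape : α ≡ m + j ∷ m + j ∷ c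
  α-shape = ∷∷-shape α α₁≡ α₂≡ (≤-trans j-positive (m≤n+m j m))
  β-shape : β ≡ j ∷ R
  β-shape = ∷-shape β (m∈rankSet⇒β₁≡j m∈rankSet) (≤-trans (s≤s z≤n) α<β)
  c-decreasing : Decreasing c
  c-decreasing = drop-decreasing 2 α-decreasing
  c-bounded : All (_< m + j) c
  c-bounded = All.map (λ x≤c₀ → ≤-<-trans x≤c₀ c₀<m+j) (all-≤-at₀ c c-decreasing)
    where
    c₀<m+j : at c 0 < m + j
    c₀<m+j = subst (_< m + j) (trans (part-suc α 2) (sym (at-drop 2 α 0))) α₃<
  isQ5Symbol : IsQ5Symbol m j c R
  isQ5Symbol = record
    { j-positive   = j-positive
    ; c-decreasing = c-decreasing
    ; c-positive   = drop⁺ 2 α-positive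
    ; c-bounded    = c-bounded
    ; R-decreasing = drop-decreasing 1 β-decreasing
    ; R-lower      = drop⁺ 1 (≤s⇒all-≤ β β-decreasing 2≤sβ)
    ; R-upper      = drop⁺ 1 β-bounded
    ; R-long       = s≤s⁻¹ (subst₂ _≤_ (cong (suc ∘ length) α-shape) (cong length β-shape) α<β)
    }

-- The injection Q₅(m,n) → P₅(−m,n)

-- Without extra parts the image is m − 1 cells short.  A part x of γ adds x + 1 cells
-- (it also lengthens the padding of δ) and a part x of δ adds x − 1, hence m − 2 in γ
-- for m ≥ 3 and 2 in δ for m = 2.
extraγ : ℕ → List ℕ
extraγ (suc (suc (suc k))) = suc k ∷ []
extraγ _                   = []

extraδ : ℕ → List ℕ
extraδ 2 = 2 ∷ []
extraδ _ = []

extraγ-parts : ∀ m → All (λ x → 1 ≤ x × 2 + x ≡ m) (extraγ m)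
extraγ-parts 0                   = []
extraγ-parts 1                   = []
extraγ-parts 2                   = []
extraγ-parts (suc (suc (suc k))) = (s≤s z≤n , refl) ∷ []

extraδ-parts : ∀ m → All (_≡ 2) (extraδ m)
extraδ-parts 0                   = []
extraδ-parts 1                   = []
extraδ-parts 2                   = refl ∷ []
extraδ-parts (suc (suc (suc k))) = []

length-extraδ : ∀ m → length (extraδ m) ≤ 1
length-extraδ 0                   = z≤n
length-extraδ 1                   = z≤n
length-extraδ 2                   = ≤-refl
length-extraδ (suc (suc (suc k))) = z≤n

extras-balance : ∀ m → 1 ≤ m → sum (extraγ m) + sum (extraδ m) + length (extraγ m) + 1 ≡ m + length (extraδ m)
extras-balance 1                   _ = refl
extras-balance 2                   _ = refl
extras-balance (suc (suc (suc k))) _ = balance k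
  where
  balance : ∀ k → suc k + 0 + 0 + 1 + 1 ≡ 3 + k + 0
  balance = solve-∀

rectangle-growth : ∀ m j → (m + suc j) * suc j ≡ (m + j) * j + (m + j + suc j)
rectangle-growth = solve-∀

weight-bookkeeping : ∀ A m j E F e f L S R ℓL ℓS ℓR sγ p →
  sγ + (ℓL + ℓR) ≡ E + (L + R) → E + F + e + 1 ≡ m + f → p + suc (f + ℓS) ≡ e + (ℓL + ℓR) →
  A + (m + j + suc j) + sγ + (suc j + (F + (ℓS * 1 + S) + p * 1)) ≡ A + (m + j + (m + j + (L + S))) + (j + R)
weight-bookkeeping A m j E F e f L S R ℓL ℓS ℓR sγ p γ-sum balance p-length =
  +-cancelʳ-≡ _ _ _ (begin
    A + (m + j + suc j) + sγ + (suc j + (F + (ℓS * 1 + S) + p * 1)) + (ℓL + ℓR + suc (f + ℓS))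
      ≡⟨ solve (A List.∷ m List.∷ j List.∷ F List.∷ f List.∷ S List.∷ ℓL List.∷ ℓS List.∷ ℓR List.∷ sγ List.∷ p List.∷ List.[]) ⟩
    A + m + j + j + j + F + ℓS + S + 2 + (sγ + (ℓL + ℓR)) + (p + suc (f + ℓS))
      ≡⟨ cong₂ (λ a b → A + m + j + j + j + F + ℓS + S + 2 + a + b) γ-sum p-length ⟩
    A + m + j + j + j + F + ℓS + S + 2 + (E + (L + R)) + (e + (ℓL + ℓR))
      ≡⟨ solve (A List.∷ m List.∷ j List.∷ E List.∷ F List.∷ e List.∷ L List.∷ S List.∷ R List.∷ ℓL List.∷ ℓS List.∷ ℓR List.∷ List.[]) ⟩
    A + m + j + j + j + ℓS + S + L + R + ℓL + ℓR + 1 + (E + F + e + 1)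
      ≡⟨ cong (A + m + j + j + j + ℓS + S + L + R + ℓL + ℓR + 1 +_) balance ⟩
    A + m + j + j + j + ℓS + S + L + R + ℓL + ℓR + 1 + (m + f)
      ≡⟨ solve (A List.∷ m List.∷ j List.∷ f List.∷ L List.∷ S List.∷ R List.∷ ℓL List.∷ ℓS List.∷ ℓR List.∷ List.[]) ⟩
    A + (m + j + (m + j + (L + S))) + (j + R) + (ℓL + ℓR + suc (f + ℓS)) ∎)
  where open ≡-Reasoning

module Encoding (m j : ℕ) (c R : List ℕ) where
  large small : List ℕ
  large = takeWhile (j <?_) c
  small = dropWhile (j <?_) c

  γ δ-middle : List ℕ
  γ        = sort (extraγ m ++ map pred (large ++ R))
  δ-middle = sort (extraδ m ++ map suc small)

  -- The subtraction does not truncate: see δ-middle-short.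
  padding : ℕ
  padding = length γ ∸ suc (length δ-middle)

  δ : List ℕ
  δ = suc j ∷ δ-middle ++ replicate padding 1

  encode : List ℕ
  encode = fromSymbol m (suc j) γ δ

  module Properties (1≤m : 1 ≤ m) (q : IsQ5Symbol m j c R) where
    open IsQ5Symbol q

    γ-↭ : γ ↭ extraγ m ++ map pred (large ++ R)
    γ-↭ = sort-↭ (extraγ m ++ map pred (large ++ R))

    δ-middle-↭ : δ-middle ↭ extraδ m ++ map suc small
    δ-middle-↭ = sort-↭ (extraδ m ++ map suc small)

    large++small : large ++ small ≡ c
    large++small = takeWhile++dropWhile (j <?_) c

    private
      c-split : ∀ {P : ℕ → Set} → All P c → All P large × All P small
      c-split Pc = ++⁻ large (subst (All _) (sym large++small) Pc)

    large-decreasing : Decreasing large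
    large-decreasing = proj₁ (++⁻-decreasing large (subst Decreasing (sym large++small) c-decreasing))

    small-decreasing : Decreasing small
    small-decreasing = proj₂ (++⁻-decreasing large (subst Decreasing (sym large++small) c-decreasing))

    large>j : All (j <_) large
    large>j = all-takeWhile (j <?_) c

    small≤j : All (_≤ j) small
    small≤j = All.map (λ x≤s₀ → ≤-trans x≤s₀ (at₀-dropWhile-< j c)) (all-≤-at₀ small small-decreasing)

    large++R-decreasing : Decreasing (large ++ R)
    large++R-decreasing = ++⁺-decreasing {t = j} large-decreasing R-decreasing (All.map <⇒≤ large>j) R-upper

    private
      suc-m≤m+suc-j : suc m ≤ m + suc j
      suc-m≤m+suc-j = ≤-trans (s≤s (m≤m+n m j)) (≤-reflexive (sym (+-suc m j)))

      extraγ-part : ∀ {x} → 1 ≤ x × 2 + x ≡ m → 1 ≤ x × 3 + x ≤ m + suc j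
      extraγ-part (1≤x , refl) = 1≤x , suc-m≤m+suc-j

      large-part : ∀ {l} → j < l × l < m + j → 1 ≤ pred l × 3 + pred l ≤ m + suc j
      large-part {suc x} (j<l , l<m+j) = ≤-trans j-positive (s≤s⁻¹ j<l) , ≤-trans (s≤s l<m+j) (≤-reflexive (sym (+-suc m j)))

      R-part : ∀ {r} → 2 ≤ r × r ≤ j → 1 ≤ pred r × 3 + pred r ≤ m + suc j
      R-part {suc x} (2≤r , r≤j) = s≤s⁻¹ 2≤r , ≤-trans (s≤s (s≤s r≤j)) (+-monoˡ-≤ (suc j) 1≤m)

    γ-parts : All (λ x → 1 ≤ x × 3 + x ≤ m + suc j) γ
    γ-parts = All-resp-↭ (↭-sym γ-↭) (++⁺ (All.map extraγ-part (extraγ-parts m))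
      (map⁺ (++⁺ (All.map large-part (All.zip (large>j , proj₁ (c-split c-bounded))))
                 (All.map R-part (All.zip (R-lower , R-upper))))))

    δ-middle-parts : All (λ x → 2 ≤ x × x ≤ suc j) δ-middle
    δ-middle-parts = All-resp-↭ (↭-sym δ-middle-↭) (++⁺ (All.map (λ { refl → ≤-refl , s≤s j-positive }) (extraδ-parts m))
      (map⁺ (All.map (λ (1≤s , s≤j) → s≤s 1≤s , s≤s s≤j) (All.zip (proj₂ (c-split c-positive) , small≤j)))))

    length-γ : length γ ≡ length (extraγ m) + (length large + length R)
    length-γ = trans (↭-length γ-↭) (trans (length-++ (extraγ m))
      (cong (length (extraγ m) +_) (trans (length-map pred (large ++ R)) (length-++ large))))

    length-δ-middle : length δ-middle ≡ length (extraδ m) + length small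
    length-δ-middle = trans (↭-length δ-middle-↭) (trans (length-++ (extraδ m))
      (cong (length (extraδ m) +_) (length-map suc small)))

    δ-middle-short : suc (length δ-middle) ≤ length γ
    δ-middle-short = begin
      suc (length δ-middle)                          ≡⟨ cong suc length-δ-middle ⟩
      suc (length (extraδ m) + length small)         ≤⟨ s≤s (+-monoˡ-≤ _ (length-extraδ m)) ⟩
      2 + length small                               ≤⟨ +-monoʳ-≤ 2 (m≤n+m _ (length large)) ⟩
      2 + (length large + length small)              ≡⟨ cong (2 +_) (trans (sym (length-++ large)) (cong length large++small)) ⟩
      2 + length c                                   ≤⟨ R-long ⟩
      length R                                       ≤⟨ m≤n+m _ (length large) ⟩
      length large + length R                        ≤⟨ m≤n+m _ (length (extraγ m)) ⟩
      length (extraγ m) + (length large + length R)  ≡⟨ length-γ ⟨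
      length γ                                       ∎
      where open ≤-Reasoning

    length-γ≡length-δ : length γ ≡ length δ
    length-γ≡length-δ = sym (begin
      suc (length (δ-middle ++ replicate padding 1))
        ≡⟨ cong suc (trans (length-++ δ-middle) (cong (length δ-middle +_) (length-replicate padding))) ⟩
      suc (length δ-middle + padding)                ≡⟨ cong suc (+-comm (length δ-middle) padding) ⟩
      suc (padding + length δ-middle)                ≡⟨ +-suc padding (length δ-middle) ⟨
      padding + suc (length δ-middle)                ≡⟨ m∸n+n≡m δ-middle-short ⟩
      length γ                                       ∎)
      where open ≡-Reasoning

    encode-isSymbol : IsSymbol m (suc j) γ δ
    encode-isSymbol = record
      { j-positive   = s≤s z≤n
      ; α-decreasing = sort-↗ (extraγ m ++ map pred (large ++ R))
      ; α-positive   = All.map proj₁ γ-parts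
      ; α-bounded    = All.map (λ {x} (_ , 3+x≤) → ≤-trans (m≤n+m x 3) 3+x≤) γ-parts
      ; β-decreasing = cons-decreasing (++⁺ (All.map proj₂ δ-middle-parts) (replicate⁺ padding (s≤s z≤n)))
          (++⁺-decreasing {t = 1} (sort-↗ (extraδ m ++ map suc small)) (replicate-decreasing padding 1)
            (All.map (λ (2≤x , _) → ≤-trans (s≤s z≤n) 2≤x) δ-middle-parts) (replicate⁺ padding ≤-refl))
      ; β-positive   = s≤s z≤n ∷ ++⁺ (All.map (λ (2≤x , _) → ≤-trans (s≤s z≤n) 2≤x) δ-middle-parts) (replicate⁺ padding ≤-refl)
      ; β-bounded    = ≤-refl ∷ ++⁺ (All.map proj₂ δ-middle-parts) (replicate⁺ padding (s≤s z≤n))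
      }

    γ-head : part γ 1 + 3 ≤ m + suc j
    γ-head with γ | γ-parts
    ... | []    | []              = +-mono-≤ 1≤m (s≤s j-positive)
    ... | x ∷ _ | (_ , 3+x≤) ∷ _  = subst (_≤ m + suc j) (+-comm 3 x) 3+x≤

    large++R-positive : All (1 ≤_) (large ++ R)
    large++R-positive = ++⁺ (proj₁ (c-split c-positive)) (All.map (≤-trans (s≤s z≤n)) R-lower)

    sum-γ : sum γ + (length large + length R) ≡ sum (extraγ m) + (sum large + sum R)
    sum-γ = begin
      sum γ + (length large + length R)
        ≡⟨ cong₂ _+_ (trans (sum-↭ γ-↭) (sum-++ (extraγ m) _)) (sym (length-++ large)) ⟩
      sum (extraγ m) + sum (map pred (large ++ R)) + length (large ++ R)
        ≡⟨ +-assoc (sum (extraγ m)) _ _ ⟩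
      sum (extraγ m) + (sum (map pred (large ++ R)) + length (large ++ R))
        ≡⟨ cong (sum (extraγ m) +_) (trans (+-comm _ (length (large ++ R))) (trans
             (cong (_+ sum (map pred (large ++ R))) (sym (conj-1 _ large++R-positive)))
             (conj-1+sum-map-pred (large ++ R)))) ⟩
      sum (extraγ m) + sum (large ++ R)
        ≡⟨ cong (sum (extraγ m) +_) (sum-++ large R) ⟩
      sum (extraγ m) + (sum large + sum R) ∎
      where open ≡-Reasoning

    sum-δ : sum δ ≡ suc j + (sum (extraδ m) + (length small * 1 + sum small) + padding * 1)
    sum-δ = cong (suc j +_) (begin
      sum (δ-middle ++ replicate padding 1)                      ≡⟨ sum-++ δ-middle _ ⟩
      sum δ-middle + sum (replicate padding 1)
        ≡⟨ cong₂ _+_ (trans (sum-↭ δ-middle-↭) (sum-++ (extraδ m) _)) (sum-replicate padding 1) ⟩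
      sum (extraδ m) + sum (map suc small) + padding * 1         ≡⟨ cong (λ s → sum (extraδ m) + s + padding * 1) (sum-map-+ 1 small) ⟩
      sum (extraδ m) + (length small * 1 + sum small) + padding * 1 ∎)
      where open ≡-Reasoning

    encode-weight : (m + suc j) * suc j + sum γ + sum δ ≡ (m + j) * j + sum (m + j ∷ m + j ∷ c) + sum (j ∷ R)
    encode-weight = begin
      (m + suc j) * suc j + sum γ + sum δ
        ≡⟨ cong₂ (λ a b → a + sum γ + b) (rectangle-growth m j) sum-δ ⟩
      (m + j) * j + (m + j + suc j) + sum γ + (suc j + (sum (extraδ m) + (length small * 1 + sum small) + padding * 1))
        ≡⟨ weight-bookkeeping ((m + j) * j) m j (sum (extraγ m)) (sum (extraδ m)) (length (extraγ m)) (length (extraδ m))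
             (sum large) (sum small) (sum R) (length large) (length small) (length R) (sum γ) padding
             sum-γ (extras-balance m 1≤m) padding-length ⟩
      (m + j) * j + (m + j + (m + j + (sum large + sum small))) + (j + sum R)
        ≡⟨ cong (λ s → (m + j) * j + (m + j + (m + j + s)) + (j + sum R)) (trans (sym (sum-++ large small)) (cong sum large++small)) ⟩
      (m + j) * j + (m + j + (m + j + sum c)) + (j + sum R) ∎
      where
      open ≡-Reasoning
      padding-length : padding + suc (length (extraδ m) + length small) ≡ length (extraγ m) + (length large + length R)
      padding-length = trans (cong (λ n → padding + suc n) (sym length-δ-middle)) (trans (m∸n+n≡m δ-middle-short) length-γ)

encoding-injective : ∀ {m j c R j′ c′ R′} → 1 ≤ m → j ≡ j′ → IsQ5Symbol m j c R → IsQ5Symbol m j′ c′ R′ →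
  Encoding.γ m j c R ≡ Encoding.γ m j′ c′ R′ → Encoding.δ m j c R ≡ Encoding.δ m j′ c′ R′ →
  c ≡ c′ × R ≡ R′
encoding-injective {m} {j} {c} {R} {_} {c′} {R′} 1≤m refl q q′ γ≡γ′ δ≡δ′ = c≡c′ , R≡R′
  where
  module E  = Encoding m j c R
  module E′ = Encoding m j c′ R′
  module P  = E.Properties 1≤m q
  module P′ = E′.Properties 1≤m q′

  large++R≡ : E.large ++ R ≡ E′.large ++ R′
  large++R≡ = map-pred-injective P.large++R-positive P′.large++R-positive
    (sort-++-cancelˡ (extraγ m) (map-pred-decreasing P.large++R-decreasing) (map-pred-decreasing P′.large++R-decreasing) γ≡γ′)

  large++R-split : E.large ≡ E′.large × R ≡ R′
  large++R-split = ++-split-unique P.large>j (All.map ≤⇒≯ (IsQ5Symbol.R-upper q))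
                              P′.large>j (All.map ≤⇒≯ (IsQ5Symbol.R-upper q′)) large++R≡

  R≡R′ : R ≡ R′
  R≡R′ = proj₂ large++R-split

  δ-middle≡ : E.δ-middle ≡ E′.δ-middle
  δ-middle≡ = proj₁ (++-split-unique (All.map proj₁ P.δ-middle-parts) (replicate⁺ _ 2≰1)
                                     (All.map proj₁ P′.δ-middle-parts) (replicate⁺ _ 2≰1) (∷-injectiveʳ δ≡δ′))
    where
    2≰1 : ¬ 2 ≤ 1
    2≰1 (s≤s ())

  small≡ : E.small ≡ E′.small
  small≡ = map-injective suc-injective
    (sort-++-cancelˡ (extraδ m) (map-suc-decreasing P.small-decreasing) (map-suc-decreasing P′.small-decreasing) δ-middle≡)

  c≡c′ : c ≡ c′
  c≡c′ = trans (sym P.large++small) (trans (cong₂ _++_ (proj₁ large++R-split) small≡) P′.large++small)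

encode-injective : ∀ {m j c R j′ c′ R′} → 1 ≤ m → IsQ5Symbol m j c R → IsQ5Symbol m j′ c′ R′ →
  Encoding.encode m j c R ≡ Encoding.encode m j′ c′ R′ → fromQ5Symbol m j c R ≡ fromQ5Symbol m j′ c′ R′
encode-injective {m} {j} {c} {R} {j′} {c′} {R′} 1≤m q q′ eq =
  trans (cong₂ (fromQ5Symbol m j) c≡c′ R≡R′) (cong (λ k → fromQ5Symbol m k c′ R′) j≡j′)
  where
  symbols≡ : suc j ≡ suc j′ × Encoding.γ m j c R ≡ Encoding.γ m j′ c′ R′ × Encoding.δ m j c R ≡ Encoding.δ m j′ c′ R′
  symbols≡ = fromSymbol-injective (Encoding.Properties.encode-isSymbol m j c R 1≤m q)
                                  (Encoding.Properties.encode-isSymbol m j′ c′ R′ 1≤m q′) eq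
  j≡j′ : j ≡ j′
  j≡j′ = suc-injective (proj₁ symbols≡)
  parts≡ : c ≡ c′ × R ≡ R′
  parts≡ = encoding-injective 1≤m j≡j′ q q′ (proj₁ (proj₂ symbols≡)) (proj₂ (proj₂ symbols≡))
  c≡c′ : c ≡ c′
  c≡c′ = proj₁ parts≡
  R≡R′ : R ≡ R′
  R≡R′ = proj₂ parts≡

q5→p5 : ℕ → List ℕ → List ℕ
q5→p5 m λs = Encoding.encode m (durfee m λs) (drop 2 (symα m λs)) (drop 1 (symβ m λs))

q5→p5-P5 : ∀ {m n λs} → 1 ≤ m → InQ5 m n λs → InP5 m n (q5→p5 m λs)
q5→p5-P5 {m} {n} {λs} 1≤m p@(((_ , sum≡n) , _) , _) =
  ((isPartition , weight) , ℤP.≤-reflexive (sym (rank-fromSymbol length-γ≡length-δ))) ,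
  subst (1 ≤_) (sym durfee-fromSymbol) (s≤s z≤n) ,
  subst₂ (λ a b → length a ≡ length b) (sym symα-fromSymbol) (sym symβ-fromSymbol) length-γ≡length-δ ,
  subst₂ (λ a d → part a 1 + 3 ≤ m + d) (sym symα-fromSymbol) (sym durfee-fromSymbol) γ-head ,
  trans (cong (λ b → part b 1) symβ-fromSymbol) (sym durfee-fromSymbol)
  where
  j : ℕ
  j = durfee m λs
  c R : List ℕ
  c = drop 2 (symα m λs)
  R = drop 1 (symβ m λs)
  q : IsQ5Symbol m j c R
  q = proj₁ (q5-decomposition p)
  open Encoding.Properties m j c R 1≤m q
  open FromSymbol encode-isSymbol renaming (fromSymbol-isPartition to isPartition)
  weight : sum (q5→p5 m λs) ≡ n
  weight = begin
    sum (q5→p5 m λs)                                            ≡⟨ sum-fromSymbol ⟩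
    (m + suc j) * suc j + sum (Encoding.γ m j c R) + sum (Encoding.δ m j c R) ≡⟨ encode-weight ⟩
    (m + j) * j + sum (m + j ∷ m + j ∷ c) + sum (j ∷ R)         ≡⟨ FromSymbol.sum-fromSymbol (q5-isSymbol q) ⟨
    sum (fromQ5Symbol m j c R)                                  ≡⟨ cong sum (proj₂ (q5-decomposition p)) ⟩
    sum λs                                                      ≡⟨ sum≡n ⟩
    n                                                           ∎
    where open ≡-Reasoning

q5→p5-injective : ∀ {m n λs μs} → 1 ≤ m → InQ5 m n λs → InQ5 m n μs → q5→p5 m λs ≡ q5→p5 m μs → λs ≡ μs
q5→p5-injective 1≤m p p′ eq =
  trans (sym (proj₂ (q5-decomposition p)))
    (trans (encode-injective 1≤m (proj₁ (q5-decomposition p)) (proj₁ (q5-decomposition p′)) eq)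
           (proj₂ (q5-decomposition p′)))

lemma4p4 : (m n : ℕ) → 1 ≤ m →
    Σ ((λs : List ℕ) → InQ5 m n λs → List ℕ) λ f →
      ((λs : List ℕ) (p : InQ5 m n λs) → InP5 m n (f λs p))
      × ((λs μs : List ℕ) (p : InQ5 m n λs) (q : InQ5 m n μs) →
           f λs p ≡ f μs q → λs ≡ μs)
lemma4p4 m n 1≤m =
  (λ λs _ → q5→p5 m λs) ,
  (λ λs → q5→p5-P5 1≤m) ,
  (λ λs μs → q5→p5-injective 1≤m)
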